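{- Let $k \ge r \ge 3$ and let $d$ be a positive integer. There is a constant $C_{k,d}$ depending only on $k$ and $d$ such that the following holds. Let $G$ be a $K_r$-partite-saturated $k$-partite graph with parts $V_1,\dots,V_k$, each of size $n$, and for each $i$ let $V_i^- = \{v \in V_i : d(v) < d\}$. Then there exists a subset $U \subseteq \bigcup_{i=1}^k V_i^-$ with $|U| \le C_{k,d}$ such that $\left(\bigcup_{i=1}^k V_i^-\right) \setminus U$ is an independent set in $G$.
   Context: All graphs are finite and simple; $d(v)$ denotes the degree of $v$ in $G$. A $k$-partite graph comes with a fixed partition of its vertex set into $k$ parts. An admissible non-edge is a non-adjacent pair of vertices in different parts. A $k$-partite graph is $K_r$-partite-saturated if it contains no $K_r$ but adding any admissible non-edge creates a copy of $K_r$. -}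

module Defs where

open import Data.Nat using (ℕ; _<_)
open import Data.Fin using (Fin)
open import Data.Bool using (Bool; true; false)
open import Data.Product using (_×_; _,_; proj₁; Σ)
open import Data.Sum using (_⊎_)
open import Data.List using (List; length; filterᵇ; allFin; concatMap; map)
open import Data.Empty using (⊥)
open import Relation.Nullary using (¬_)
open import Relation.Binary.PropositionalEquality using (_≡_; _≢_)

-- Vertices of a k-partite graph with k parts of size n:
-- (i , j) is the j-th vertex of part V_i.
Vertex : ℕ → ℕ → Set
Vertex k n = Fin k × Fin n

part : ∀ {k n} → Vertex k n → Fin k
part = proj₁

vertices : (k n : ℕ) → List (Vertex k n)
vertices k n = concatMap (λ i → map (λ j → (i , j)) (allFin n)) (allFin k)

record KPartiteGraph (k n : ℕ) : Set where
  field
    adj      : Vertex k n → Vertex k n → Bool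
    adj-sym  : ∀ x y → adj x y ≡ adj y x
    adj-part : ∀ x y → part x ≡ part y → adj x y ≡ false

open KPartiteGraph public

Edge : ∀ {k n} → KPartiteGraph k n → Vertex k n → Vertex k n → Set
Edge G x y = adj G x y ≡ true

degree : ∀ {k n} → KPartiteGraph k n → Vertex k n → ℕ
degree {k} {n} G v = length (filterᵇ (adj G v) (vertices k n))

HasClique : ∀ {V : Set} → ℕ → (V → V → Set) → Set
HasClique {V} r R =
  Σ (Fin r → V) λ f →
    (∀ i j → f i ≡ f j → i ≡ j) × (∀ i j → i ≢ j → R (f i) (f j))

EdgePlus : ∀ {k n} → KPartiteGraph k n → Vertex k n → Vertex k n →
           Vertex k n → Vertex k n → Set
EdgePlus G u v x y = Edge G x y ⊎ ((x ≡ u × y ≡ v) ⊎ (x ≡ v × y ≡ u))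

Saturated : ∀ {k n} → ℕ → KPartiteGraph k n → Set
Saturated r G =
  ¬ HasClique r (Edge G) ×
  (∀ u v → part u ≢ part v → adj G u v ≡ false → HasClique r (EdgePlus G u v))

module Submission where

-- Call a vertex low if its degree is below d, and let U be the set
-- of low vertices having a low neighbour; low vertices outside U are then
-- independent, so the whole content is that |U| is bounded in terms of k and d.
-- Give every b ∈ U a low neighbour partner(b) and colour each ordered pair
-- (a , b) of U by colour(a , partner b), which records whether the two vertices
-- lie in one part, or else how a sits in the neighbour list of partner(b), or
-- else how the K_r created by adding the non-edge sits in the neighbour lists of
-- its two ends.  Since all degrees involved are below d, only finitely many
-- colours (depending on k and d alone) occur.  An ordered Ramsey argument turns a
-- large U into a monochromatic triangle, and each kind of colour rules out such a
-- triangle: in the last case the three saturating cliques agree vertex by vertex,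
-- and exchanging an endpoint produces a K_r in G itself.

open import Defs
open import Data.Nat using (ℕ; zero; suc; _+_; _*_; _≤_; _<_; z≤n; s≤s) renaming (_≟_ to _≟ℕ_)
open import Data.Nat.Properties
open import Data.Fin using (Fin)
import Data.Fin as Fin
import Data.Fin.Properties as Fin
open import Data.Bool using (true; false; T)
import Data.Bool.Properties as Bool
open import Data.Product using (Σ; ∃-syntax; _×_; _,_; proj₁; proj₂)
open import Data.Product.Properties using (≡-dec)
open import Data.Sum using (_⊎_; inj₁; inj₂; [_,_])
open import Data.Empty using (⊥; ⊥-elim)
open import Data.List using (List; []; _∷_; length; map; filter; filterᵇ; allFin; upTo;
  _++_; cartesianProduct; cartesianProductWith; concatMap)
open import Data.List.Properties using (filter-notAll; length-map; length-tabulate; ∷-injectiveˡ; ∷-injectiveʳ)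
import Data.List.Properties as List
open import Data.List.Relation.Unary.All using (All; []; _∷_)
import Data.List.Relation.Unary.All as All
open import Data.List.Relation.Unary.All.Properties using (¬Any⇒All¬) renaming (map⁺ to All-map⁺)
open import Data.List.Relation.Unary.Any using (Any; here; there; any?; satisfied)
import Data.List.Relation.Unary.Any as Any
open import Data.List.Relation.Unary.AllPairs using (AllPairs; []; _∷_)
import Data.List.Relation.Unary.AllPairs as AllPairs
import Data.List.Relation.Unary.AllPairs.Properties as AllPairs
open import Data.List.Relation.Unary.Unique.Propositional using (Unique)
import Data.List.Relation.Unary.Unique.Propositional.Properties as Unique
open import Data.List.Membership.Propositional using (_∈_; _∉_; find; lose)
open import Data.List.Membership.Propositional.Properties
  using (∈-filter⁺; ∈-filter⁻; ∈-map⁺; ∈-++⁺ˡ; ∈-++⁺ʳ; ∈-allFin; ∈-upTo⁺;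
         ∈-cartesianProduct⁺; ∈-cartesianProductWith⁺)
open import Data.List.Relation.Binary.Subset.Propositional using (_⊆_)
import Data.List.Relation.Binary.Sublist.Propositional.Properties as Sublist
open import Relation.Nullary using (¬_; Dec; yes; no; ¬?)
import Relation.Nullary.Decidable as Dec
open import Relation.Nullary.Decidable using (_×-dec_)
open import Relation.Binary.Definitions using (DecidableEquality)
open import Relation.Binary.PropositionalEquality
  using (_≡_; _≢_; refl; sym; trans; cong; subst)

module _ {A : Set} where

  length-filter-split : ∀ {P : A → Set} (P? : ∀ x → Dec (P x)) xs →
    length (filter P? xs) + length (filter (λ x → ¬? (P? x)) xs) ≡ length xs
  length-filter-split P? [] = refl
  length-filter-split P? (x ∷ xs) with P? x
  ... | yes _ = cong suc (length-filter-split P? xs)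
  ... | no _ = trans (+-suc _ _) (cong suc (length-filter-split P? xs))

  length-filter-filter : ∀ {P Q : A → Set} (P? : ∀ x → Dec (P x)) (Q? : ∀ x → Dec (Q x)) xs →
    length (filter P? (filter Q? xs)) ≤ length (filter P? xs)
  length-filter-filter P? Q? xs =
    Sublist.length-mono-≤ (Sublist.filter⁺ P? P? (λ { refl p → p }) (Sublist.filter-⊆ Q? xs))

  allPairs-from-∈ : ∀ {R : A → A → Set} xs → (∀ {a b} → a ∈ xs → b ∈ xs → R a b) → AllPairs R xs
  allPairs-from-∈ [] R∈ = []
  allPairs-from-∈ (x ∷ xs) R∈ =
    All.tabulate (λ b∈ → R∈ (here refl) (there b∈)) ∷
    allPairs-from-∈ xs (λ a∈ b∈ → R∈ (there a∈) (there b∈))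

  map-pointwise : ∀ {B : Set} (f g : A → B) xs → map f xs ≡ map g xs → ∀ {x} → x ∈ xs → f x ≡ g x
  map-pointwise f g (y ∷ xs) eq (here refl) = ∷-injectiveˡ eq
  map-pointwise f g (y ∷ xs) eq (there x∈) = map-pointwise f g xs (∷-injectiveʳ eq) x∈

  listsUpTo : ℕ → List A → List (List A)
  listsUpTo zero xs = [] ∷ []
  listsUpTo (suc L) xs = [] ∷ cartesianProductWith _∷_ xs (listsUpTo L xs)

  ∈-listsUpTo : ∀ {xs} L ys → length ys ≤ L → All (_∈ xs) ys → ys ∈ listsUpTo L xs
  ∈-listsUpTo zero [] _ _ = here refl
  ∈-listsUpTo (suc L) [] _ _ = here refl
  ∈-listsUpTo (suc L) (y ∷ ys) (s≤s len) (y∈ ∷ ys∈) =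
    there (∈-cartesianProductWith⁺ _∷_ y∈ (∈-listsUpTo L ys len ys∈))

module Position {A : Set} (_≟_ : DecidableEquality A) where

  -- The index of the first occurrence of x in a list (its length if absent).
  position : A → List A → ℕ
  position x [] = 0
  position x (y ∷ ys) with x ≟ y
  ... | yes _ = 0
  ... | no _ = suc (position x ys)

  position-≤ : ∀ x ys → position x ys ≤ length ys
  position-≤ x [] = z≤n
  position-≤ x (y ∷ ys) with x ≟ y
  ... | yes _ = z≤n
  ... | no _ = s≤s (position-≤ x ys)

  position-injective : ∀ {x x'} ys → x ∈ ys → x' ∈ ys → position x ys ≡ position x' ys → x ≡ x'
  position-injective {x} {x'} (y ∷ ys) x∈ x'∈ eq with x ≟ y | x' ≟ y | eq
  ... | yes x≡y | yes x'≡y | _ = trans x≡y (sym x'≡y)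
  ... | no x≢y | no x'≢y | eq' =
    position-injective ys (Any.tail x≢y x∈) (Any.tail x'≢y x'∈) (suc-injective eq')
  ... | yes _ | no _ | ()
  ... | no _ | yes _ | ()

module Pigeonhole {A C : Set} (_≟_ : DecidableEquality C) (h : A → C) where

  colourClass : C → List A → List A
  colourClass c = filter (λ x → h x ≟ c)

  pigeonhole : ∀ K cs xs → All (λ x → h x ∈ cs) xs → length cs * K < length xs →
               ∃[ c ] c ∈ cs × K < length (colourClass c xs)
  pigeonhole K [] [] _ ()
  pigeonhole K [] (x ∷ xs) (() ∷ _) _
  pigeonhole K (c ∷ cs) xs coloured many with K <? length (colourClass c xs)
  ... | yes big = c , here refl , big
  ... | no notBig =
    let (c' , c'∈ , big) = pigeonhole K cs others others-coloured others-many
    in c' , there c'∈ , <-≤-trans big (length-filter-filter (λ x → h x ≟ c') notC xs)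
    where
    notC : ∀ x → Dec (h x ≢ c)
    notC x = ¬? (h x ≟ c)

    others : List A
    others = filter notC xs

    others-coloured : All (λ x → h x ∈ cs) others
    others-coloured = All.tabulate λ x∈ →
      let (x∈xs , x≢c) = ∈-filter⁻ notC x∈ in Any.tail x≢c (All.lookup coloured x∈xs)

    others-many : length cs * K < length others
    others-many = +-cancelˡ-< K _ _ (begin-strict
      K + length cs * K                          <⟨ many ⟩
      length xs                                  ≡⟨ sym (length-filter-split (λ x → h x ≟ c) xs) ⟩
      length (colourClass c xs) + length others  ≤⟨ +-monoˡ-≤ (length others) (≮⇒≥ notBig) ⟩
      K + length others                          ∎)
      where open ≤-Reasoning

ramseyBound : ℕ → ℕ
ramseyBound zero = 2
ramseyBound (suc m) = 2 + suc m * ramseyBound m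

module OrderedRamsey {A C : Set} (_≟_ : DecidableEquality C) (χ : A → A → C) (R : A → A → Set) where

  record Triangle (xs : List A) : Set where
    constructor triangle
    field
      a b c : A
      a∈ : a ∈ xs
      b∈ : b ∈ xs
      c∈ : c ∈ xs
      related : R a b
      ab≡ac : χ a b ≡ χ a c
      bc≡ac : χ b c ≡ χ a c

  triangle-⊆ : ∀ {xs ys} → xs ⊆ ys → Triangle xs → Triangle ys
  triangle-⊆ sub (triangle a b c a∈ b∈ c∈ r ab bc) = triangle a b c (sub a∈) (sub b∈) (sub c∈) r ab bc

  pairOfColour? : ∀ c ys →
    (∃[ x ] ∃[ y ] x ∈ ys × y ∈ ys × χ x y ≡ c) ⊎ AllPairs (λ x y → χ x y ≢ c) ys
  pairOfColour? c [] = inj₂ []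
  pairOfColour? c (x ∷ ys) with any? (λ y → χ x y ≟ c) ys | pairOfColour? c ys
  ... | yes found | _ = let (y , y∈ , e) = find found in inj₁ (x , y , here refl , there y∈ , e)
  ... | no _ | inj₁ (u , v , u∈ , v∈ , e) = inj₁ (u , v , there u∈ , there v∈ , e)
  ... | no none | inj₂ avoid = inj₂ (¬Any⇒All¬ ys none ∷ avoid)

  open Pigeonhole {A} _≟_

  without : C → List C → List C
  without c = filter (λ c' → ¬? (c' ≟ c))

  without-shorter : ∀ {c cs} → c ∈ cs → length (without c cs) < length cs
  without-shorter {c} {cs} c∈ = filter-notAll (λ c' → ¬? (c' ≟ c)) cs (Any.map (λ e c≢c → c≢c (sym e)) c∈)

  drop-unused : ∀ {c cs ys} → AllPairs (λ x y → χ x y ∈ cs) ys → AllPairs (λ x y → χ x y ≢ c) ys →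
                AllPairs (λ x y → χ x y ∈ without c cs) ys
  drop-unused {c} coloured avoid =
    AllPairs.zipWith (λ (x∈cs , x≢c) → ∈-filter⁺ (λ c' → ¬? (c' ≟ c)) x∈cs x≢c) (coloured , avoid)

  close-at-head : ∀ {a rest c b b'} → All (R a) rest →
    b ∈ colourClass (χ a) c rest → b' ∈ colourClass (χ a) c rest → χ b b' ≡ c → Triangle (a ∷ rest)
  close-at-head {a} {rest} {c} {b} {b'} Ra b∈ b'∈ bb'≡c =
    let (b∈rest , ab≡c) = ∈-filter⁻ (λ x → χ a x ≟ c) {xs = rest} b∈
        (b'∈rest , ab'≡c) = ∈-filter⁻ (λ x → χ a x ≟ c) {xs = rest} b'∈
    in triangle a b b' (here refl) (there b∈rest) (there b'∈rest)
         (All.lookup Ra b∈rest) (trans ab≡c (sym ab'≡c)) (trans bb'≡c (sym ab'≡c))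

  -- The head a has a colour class of size > ramseyBound (m - 1); inside it either
  -- some pair closes a triangle with a, or that colour is absent and we recurse
  -- with one colour fewer.
  ramsey : ∀ m cs → length cs ≤ m → ∀ xs → AllPairs R xs →
           AllPairs (λ x y → χ x y ∈ cs) xs → ramseyBound m ≤ length xs → Triangle xs
  ramsey zero [] _ (_ ∷ _ ∷ _) _ ((() ∷ _) ∷ _) _
  ramsey zero [] _ (_ ∷ []) _ _ (s≤s ())
  ramsey (suc m) cs cs≤ (a ∷ rest) (Ra ∷ Rrest) (χa ∷ χrest) (s≤s bound)
    with c , c∈ , large ← pigeonhole (χ a) (ramseyBound m) cs rest χa
                            (≤-trans (s≤s (*-monoˡ-≤ (ramseyBound m) cs≤)) bound)
    with pairOfColour? c (colourClass (χ a) c rest)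
  ... | inj₁ (b , b' , b∈ , b'∈ , bb'≡c) = close-at-head Ra b∈ b'∈ bb'≡c
  ... | inj₂ avoid =
    triangle-⊆ (λ x∈ → there (proj₁ (∈-filter⁻ (λ x → χ a x ≟ c) {xs = rest} x∈)))
      (ramsey m (without c cs) (≤-pred (≤-trans (without-shorter c∈) cs≤)) (colourClass (χ a) c rest)
        (AllPairs.filter⁺ (λ x → χ a x ≟ c) Rrest)
        (drop-unused (AllPairs.filter⁺ (λ x → χ a x ≟ c) χrest) avoid)
        (<⇒≤ large))

-- How a vertex w of a K_r in G + uv is seen from the new edge uv: it is u, it is
-- v, or it is a common neighbour of u and v at the given positions of their
-- neighbour lists.
data Code : Set where
  isU isV : Code
  at : ℕ → ℕ → Code

-- The colour of a pair (u , v): same part; adjacent, with u at the given position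
-- of v's neighbour list; or non-adjacent, with the codes of the vertices of the
-- K_r created by adding uv.
data Colour : Set where
  samePart : Colour
  adjacentAt : ℕ → Colour
  saturatedBy : List Code → Colour

_≟ᶜ_ : DecidableEquality Code
isU ≟ᶜ isU = yes refl
isV ≟ᶜ isV = yes refl
at p q ≟ᶜ at p' q' =
  Dec.map′ (λ { (refl , refl) → refl }) (λ { refl → refl , refl }) ((p ≟ℕ p') ×-dec (q ≟ℕ q'))
isU ≟ᶜ isV = no λ ()
isU ≟ᶜ at _ _ = no λ ()
isV ≟ᶜ isU = no λ ()
isV ≟ᶜ at _ _ = no λ ()
at _ _ ≟ᶜ isU = no λ ()
at _ _ ≟ᶜ isV = no λ ()

_≟ᶜᵒˡ_ : DecidableEquality Colour
samePart ≟ᶜᵒˡ samePart = yes refl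
adjacentAt p ≟ᶜᵒˡ adjacentAt q = Dec.map′ (cong adjacentAt) (λ { refl → refl }) (p ≟ℕ q)
saturatedBy s ≟ᶜᵒˡ saturatedBy t =
  Dec.map′ (cong saturatedBy) (λ { refl → refl }) (List.≡-dec _≟ᶜ_ s t)
samePart ≟ᶜᵒˡ adjacentAt _ = no λ ()
samePart ≟ᶜᵒˡ saturatedBy _ = no λ ()
adjacentAt _ ≟ᶜᵒˡ samePart = no λ ()
adjacentAt _ ≟ᶜᵒˡ saturatedBy _ = no λ ()
saturatedBy _ ≟ᶜᵒˡ samePart = no λ ()
saturatedBy _ ≟ᶜᵒˡ adjacentAt _ = no λ ()

codes : ℕ → List Code
codes d = isU ∷ isV ∷ cartesianProductWith at (upTo d) (upTo d)

palette : ℕ → ℕ → List Colour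
palette k d = samePart ∷ map adjacentAt (upTo d) ++ map saturatedBy (listsUpTo k (codes d))

vertices-product : ∀ {k n} (is : List (Fin k)) →
  concatMap (λ i → map (λ j → (i , j)) (allFin n)) is ≡ cartesianProduct is (allFin n)
vertices-product [] = refl
vertices-product {n = n} (i ∷ is) = cong (map (λ j → (i , j)) (allFin n) ++_) (vertices-product is)

∈-vertices : ∀ {k n} (v : Vertex k n) → v ∈ vertices k n
∈-vertices {k} (i , j) =
  subst ((i , j) ∈_) (sym (vertices-product (allFin k))) (∈-cartesianProduct⁺ (∈-allFin i) (∈-allFin j))

vertices-unique : ∀ k n → Unique (vertices k n)
vertices-unique k n =
  subst Unique (sym (vertices-product (allFin k)))
    (Unique.cartesianProduct⁺ (Unique.allFin⁺ k) (Unique.allFin⁺ n))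

module SaturatedGraph {k n r : ℕ} (G : KPartiteGraph k n) (saturated : Saturated r G) where

  V : Set
  V = Vertex k n

  _≟ᵛ_ : DecidableEquality V
  _≟ᵛ_ = ≡-dec Fin._≟_ Fin._≟_

  IsClique : (V → V → Set) → (Fin r → V) → Set
  IsClique E F = (∀ i j → F i ≡ F j → i ≡ j) × (∀ i j → i ≢ j → E (F i) (F j))

  K-free : ∀ {F} → ¬ IsClique (Edge G) F
  K-free {F} clique = proj₁ saturated (F , clique)

  edge-sym : ∀ {x y} → Edge G x y → Edge G y x
  edge-sym {x} {y} e = trans (adj-sym G y x) e

  edge-across : ∀ {x y} → Edge G x y → part x ≢ part y
  edge-across {x} {y} e same with () ← trans (sym (adj-part G x y same)) e

  edge-irreflexive : ∀ {x y} → Edge G x y → x ≢ y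
  edge-irreflexive e x≡y = edge-across e (cong part x≡y)

  old-edge : ∀ {u v x y} → EdgePlus G u v x y → ¬ (x ≡ u × y ≡ v) → ¬ (x ≡ v × y ≡ u) → Edge G x y
  old-edge (inj₁ e) _ _ = e
  old-edge (inj₂ (inj₁ uv)) not-uv _ = ⊥-elim (not-uv uv)
  old-edge (inj₂ (inj₂ vu)) _ not-vu = ⊥-elim (not-vu vu)

  -- As G has no K_r, every K_r of G + uv contains both u and v.
  endpoint-in-clique : ∀ {u v w F} → IsClique (EdgePlus G u v) F → w ≡ u ⊎ w ≡ v → ∃[ i ] F i ≡ w
  endpoint-in-clique {u} {v} {w} {F} (inj , edges) w∈uv with Fin.any? (λ i → F i ≟ᵛ w)
  ... | yes found = found
  ... | no missing =
    ⊥-elim (K-free (inj , λ i j i≢j → old-edge (edges i j i≢j) (avoid w∈uv i j) (avoid′ w∈uv i j)))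
    where
    avoid : w ≡ u ⊎ w ≡ v → ∀ i j → ¬ (F i ≡ u × F j ≡ v)
    avoid (inj₁ refl) i j (Fi≡u , _) = missing (i , Fi≡u)
    avoid (inj₂ refl) i j (_ , Fj≡v) = missing (j , Fj≡v)
    avoid′ : w ≡ u ⊎ w ≡ v → ∀ i j → ¬ (F i ≡ v × F j ≡ u)
    avoid′ (inj₁ refl) i j (_ , Fj≡u) = missing (j , Fj≡u)
    avoid′ (inj₂ refl) i j (Fi≡v , _) = missing (i , Fi≡v)

  endpoint-adjacent : ∀ {u v w F} → IsClique (EdgePlus G u v) F → w ≡ u ⊎ w ≡ v →
                      ∀ l → F l ≢ u → F l ≢ v → Edge G w (F l)
  endpoint-adjacent {u} {v} {w} {F} clique@(_ , edges) w∈uv l Fl≢u Fl≢v =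
    let (i , Fi≡w) = endpoint-in-clique clique w∈uv
        i≢l : i ≢ l
        i≢l = λ { refl → [ (λ w≡u → Fl≢u (trans Fi≡w w≡u)) ,
                           (λ w≡v → Fl≢v (trans Fi≡w w≡v)) ] w∈uv }
    in subst (λ x → Edge G x (F l)) Fi≡w
         (old-edge (edges i l i≢l) (λ (_ , Fl≡v) → Fl≢v Fl≡v) (λ (_ , Fl≡u) → Fl≢u Fl≡u))

  -- Replacing the endpoint v of a K_r of G + uv by a vertex w adjacent to all its
  -- other vertices yields a K_r of G; so no such w exists.
  no-replacement : ∀ {u v w F} → IsClique (EdgePlus G u v) F → ¬ (∀ l → F l ≢ v → Edge G w (F l))
  no-replacement {u} {v} {w} {F} (inj , edges) sees = K-free (H-inj , H-edges)
    where
    H : Fin r → V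
    H l with F l ≟ᵛ v
    ... | yes _ = w
    ... | no _ = F l

    H-edges : ∀ l l' → l ≢ l' → Edge G (H l) (H l')
    H-edges l l' l≢l' with F l ≟ᵛ v | F l' ≟ᵛ v
    ... | yes Fl≡v | yes Fl'≡v = ⊥-elim (l≢l' (inj l l' (trans Fl≡v (sym Fl'≡v))))
    ... | yes _ | no Fl'≢v = sees l' Fl'≢v
    ... | no Fl≢v | yes _ = edge-sym (sees l Fl≢v)
    ... | no Fl≢v | no Fl'≢v = old-edge (edges l l' l≢l') (λ (_ , e) → Fl'≢v e) (λ (e , _) → Fl≢v e)

    H-inj : ∀ l l' → H l ≡ H l' → l ≡ l'
    H-inj l l' eq with l Fin.≟ l'
    ... | yes l≡l' = l≡l'
    ... | no l≢l' = ⊥-elim (edge-irreflexive (H-edges l l' l≢l') eq)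

  open Position _≟ᵛ_

  N : V → List V
  N u = filterᵇ (adj G u) (vertices k n)

  ∈-N : ∀ {u w} → Edge G u w → w ∈ N u
  ∈-N {u} {w} e = ∈-filter⁺ (λ x → Bool.T? (adj G u x)) (∈-vertices w) (subst T (sym e) _)

  slot : V → V → ℕ
  slot u w = position w (N u)

  slot-≤ : ∀ u w → slot u w ≤ degree G u
  slot-≤ u w = position-≤ w (N u)

  slot-injective : ∀ {u w w'} → Edge G u w → Edge G u w' → slot u w ≡ slot u w' → w ≡ w'
  slot-injective {u} e e' = position-injective (N u) (∈-N e) (∈-N e')

  code : V → V → V → Code
  code u v w with w ≟ᵛ u | w ≟ᵛ v
  ... | yes _ | _ = isU
  ... | no _ | yes _ = isV
  ... | no _ | no _ = at (slot u w) (slot v w)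

  data CodeView (u v w : V) : Code → Set where
    isU : w ≡ u → CodeView u v w isU
    isV : w ≢ u → w ≡ v → CodeView u v w isV
    at : ∀ {p q} → w ≢ u → w ≢ v → slot u w ≡ p → slot v w ≡ q → CodeView u v w (at p q)

  codeView : ∀ u v w → CodeView u v w (code u v w)
  codeView u v w with w ≟ᵛ u | w ≟ᵛ v
  ... | yes w≡u | _ = isU w≡u
  ... | no w≢u | yes w≡v = isV w≢u w≡v
  ... | no w≢u | no w≢v = at w≢u w≢v refl refl

  saturatingClique : ∀ u v → part u ≢ part v → adj G u v ≡ false → Fin r → V
  saturatingClique u v diff e = proj₁ (proj₂ saturated u v diff e)

  isSaturatingClique : ∀ u v diff e → IsClique (EdgePlus G u v) (saturatingClique u v diff e)
  isSaturatingClique u v diff e = proj₂ (proj₂ saturated u v diff e)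

  signature : V → V → (Fin r → V) → List Code
  signature u v F = map (λ l → code u v (F l)) (allFin r)

  colour : V → V → Colour
  colour u v with part u Fin.≟ part v | adj G u v Bool.≟ true
  ... | yes _ | _ = samePart
  ... | no _ | yes _ = adjacentAt (slot v u)
  ... | no diff | no nonAdj = saturatedBy (signature u v (saturatingClique u v diff (Bool.¬-not nonAdj)))

  data ColourView (u v : V) : Colour → Set where
    samePart : part u ≡ part v → ColourView u v samePart
    adjacentAt : ∀ {q} → Edge G u v → slot v u ≡ q → ColourView u v (adjacentAt q)
    saturatedBy : ∀ {s} diff e → signature u v (saturatingClique u v diff e) ≡ s →
                  ColourView u v (saturatedBy s)

  colourView : ∀ u v → ColourView u v (colour u v)
  colourView u v with part u Fin.≟ part v | adj G u v Bool.≟ true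
  ... | yes same | _ = samePart same
  ... | no _ | yes e = adjacentAt e refl
  ... | no diff | no nonAdj = saturatedBy diff (Bool.¬-not nonAdj) refl

  -- Let b ~ yb, and let K₁, K₂, K₃ be K_r's of G + a yb, G + a yc, G + b yc whose
  -- codes agree index by index.  At an index where K₃ has a common neighbour of b
  -- and yc, the three vertices share their slot at a (K₁, K₂) and at yc (K₂, K₃),
  -- so they coincide and are adjacent to yb.  Hence yb can replace yc in K₃.
  agreeing-cliques : ∀ {a b yb yc F₁ F₂ F₃} → Edge G b yb →
    IsClique (EdgePlus G a yb) F₁ → IsClique (EdgePlus G a yc) F₂ → IsClique (EdgePlus G b yc) F₃ →
    (∀ l → code a yb (F₁ l) ≡ code b yc (F₃ l)) → (∀ l → code a yc (F₂ l) ≡ code b yc (F₃ l)) → ⊥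
  agreeing-cliques {a} {b} {yb} {yc} {F₁} {F₂} {F₃} b~yb K₁ K₂ K₃ same₁₃ same₂₃ =
    no-replacement K₃ yb-sees
    where
    sees-via-codes : ∀ l {c} → CodeView a yb (F₁ l) c → CodeView a yc (F₂ l) c → CodeView b yc (F₃ l) c →
                     F₃ l ≢ yc → Edge G yb (F₃ l)
    sees-via-codes l _ _ (isU F₃l≡b) _ = subst (Edge G yb) (sym F₃l≡b) (edge-sym b~yb)
    sees-via-codes l _ _ (isV _ F₃l≡yc) F₃l≢yc = ⊥-elim (F₃l≢yc F₃l≡yc)
    sees-via-codes l (at ≢a₁ ≢yb₁ p₁ _) (at ≢a₂ ≢yc₂ p₂ q₂) (at ≢b₃ ≢yc₃ _ q₃) _ =
      let F₁≡F₂ = slot-injective (endpoint-adjacent K₁ (inj₁ refl) l ≢a₁ ≢yb₁)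
                                 (endpoint-adjacent K₂ (inj₁ refl) l ≢a₂ ≢yc₂) (trans p₁ (sym p₂))
          F₂≡F₃ = slot-injective (endpoint-adjacent K₂ (inj₂ refl) l ≢a₂ ≢yc₂)
                                 (endpoint-adjacent K₃ (inj₂ refl) l ≢b₃ ≢yc₃) (trans q₂ (sym q₃))
      in subst (Edge G yb) (trans F₁≡F₂ F₂≡F₃) (endpoint-adjacent K₁ (inj₂ refl) l ≢a₁ ≢yb₁)

    yb-sees : ∀ l → F₃ l ≢ yc → Edge G yb (F₃ l)
    yb-sees l = sees-via-codes l (subst (CodeView a yb (F₁ l)) (same₁₃ l) (codeView a yb (F₁ l)))
                                 (subst (CodeView a yc (F₂ l)) (same₂₃ l) (codeView a yc (F₂ l)))
                                 (codeView b yc (F₃ l))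

  no-monochromatic-triangle : ∀ {a b yb yc κ} → a ≢ b → Edge G b yb →
    ColourView a yb κ → ColourView a yc κ → ColourView b yc κ → ⊥
  no-monochromatic-triangle _ b~yb (samePart a∼yb) (samePart a∼yc) (samePart b∼yc) =
    edge-across b~yb (trans b∼yc (trans (sym a∼yc) a∼yb))
  no-monochromatic-triangle a≢b _ (adjacentAt _ _) (adjacentAt a~yc qa) (adjacentAt b~yc qb) =
    a≢b (slot-injective (edge-sym a~yc) (edge-sym b~yc) (trans qa (sym qb)))
  no-monochromatic-triangle {a} {b} {yb} {yc} _ b~yb
    (saturatedBy diff₁ e₁ sig₁) (saturatedBy diff₂ e₂ sig₂) (saturatedBy diff₃ e₃ sig₃) =
    agreeing-cliques b~yb (isSaturatingClique a yb diff₁ e₁) (isSaturatingClique a yc diff₂ e₂)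
      (isSaturatingClique b yc diff₃ e₃) (agree (trans sig₁ (sym sig₃))) (agree (trans sig₂ (sym sig₃)))
    where
    agree : ∀ {u v u' v' F F'} → signature u v F ≡ signature u' v' F' →
            ∀ l → code u v (F l) ≡ code u' v' (F' l)
    agree eq l = map-pointwise _ _ (allFin r) eq (∈-allFin l)

  module LowVertices (d : ℕ) where

    Low : V → Set
    Low x = degree G x < d

    low? : ∀ x → Dec (Low x)
    low? x = degree G x <? d

    slot-< : ∀ {u} w → Low u → slot u w < d
    slot-< {u} w low = ≤-<-trans (slot-≤ u w) low

    code-in-palette : ∀ {u v w c} → Low u → Low v → CodeView u v w c → c ∈ codes d
    code-in-palette _ _ (isU _) = here refl
    code-in-palette _ _ (isV _ _) = there (here refl)
    code-in-palette {w = w} low-u low-v (at _ _ refl refl) =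
      there (there (∈-cartesianProductWith⁺ at (∈-upTo⁺ (slot-< w low-u)) (∈-upTo⁺ (slot-< w low-v))))

    -- Pairs of low vertices are coloured from the palette (a K_r has r ≤ k codes).
    colour-in-palette : r ≤ k → ∀ {u v κ} → Low u → Low v → ColourView u v κ → κ ∈ palette k d
    colour-in-palette _ _ _ (samePart _) = here refl
    colour-in-palette _ {u} _ low-v (adjacentAt _ refl) =
      there (∈-++⁺ˡ (∈-map⁺ adjacentAt (∈-upTo⁺ (slot-< u low-v))))
    colour-in-palette r≤k {u} {v} low-u low-v (saturatedBy diff e refl) =
      there (∈-++⁺ʳ (map adjacentAt (upTo d)) (∈-map⁺ saturatedBy (∈-listsUpTo k _ short coded)))
      where
      F : Fin r → V
      F = saturatingClique u v diff e

      short : length (signature u v F) ≤ k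
      short = subst (_≤ k) (sym (trans (length-map _ (allFin r)) (length-tabulate (λ l → l)))) r≤k
      coded : All (_∈ codes d) (signature u v F)
      coded = All-map⁺ (All.tabulate λ {l} _ → code-in-palette low-u low-v (codeView u v (F l)))

    LowNeighbour : V → V → Set
    LowNeighbour x y = Low y × Edge G x y

    lowNeighbour? : ∀ x y → Dec (LowNeighbour x y)
    lowNeighbour? x y = low? y ×-dec (adj G x y Bool.≟ true)

    inU? : ∀ x → Dec (Low x × Any (LowNeighbour x) (vertices k n))
    inU? x = low? x ×-dec any? (lowNeighbour? x) (vertices k n)

    U : List V
    U = filter inU? (vertices k n)

    U-low : All Low U
    U-low = All.tabulate (λ x∈U → proj₁ (proj₂ (∈-filter⁻ inU? {xs = vertices k n} x∈U)))

    U-covers : ∀ x y → Low x → Low y → x ∉ U → y ∉ U → adj G x y ≡ false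
    U-covers x y low-x low-y x∉U _ with adj G x y Bool.≟ true
    ... | yes x~y = ⊥-elim (x∉U (∈-filter⁺ inU? (∈-vertices x) (low-x , lose (∈-vertices y) (low-y , x~y))))
    ... | no x≁y = Bool.¬-not x≁y

    partner : V → V
    partner x with any? (lowNeighbour? x) (vertices k n)
    ... | yes found = proj₁ (satisfied found)
    ... | no _ = x

    partner-spec : ∀ {x} → x ∈ U → LowNeighbour x (partner x)
    partner-spec {x} x∈U with any? (lowNeighbour? x) (vertices k n)
    ... | yes found = proj₂ (satisfied found)
    ... | no none = ⊥-elim (none (proj₂ (proj₂ (∈-filter⁻ inU? {xs = vertices k n} x∈U))))

    -- Colour the ordered pair (a , b) of U by the colour of (a , partner b); a
    -- Ramsey triangle a, b, c would contradict no-monochromatic-triangle.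
    χ : V → V → Colour
    χ a b = colour a (partner b)

    open OrderedRamsey _≟ᶜᵒˡ_ χ _≢_

    U-small : r ≤ k → length U ≤ ramseyBound (length (palette k d))
    U-small r≤k with length U ≤? ramseyBound (length (palette k d))
    ... | yes small = small
    ... | no large =
      let triangle a b c _ b∈ _ a≢b ab≡ac bc≡ac =
            ramsey (length (palette k d)) (palette k d) ≤-refl U
              (Unique.filter⁺ inU? {vertices k n} (vertices-unique k n))
              (allPairs-from-∈ U coloured) (<⇒≤ (≰⇒> large))
      in ⊥-elim (no-monochromatic-triangle a≢b (proj₂ (partner-spec b∈))
           (subst (ColourView a (partner b)) ab≡ac (colourView a (partner b)))
           (colourView a (partner c))
           (subst (ColourView b (partner c)) bc≡ac (colourView b (partner c))))
      where
      coloured : ∀ {a b} → a ∈ U → b ∈ U → χ a b ∈ palette k d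
      coloured {a} {b} a∈ b∈ =
        colour-in-palette r≤k (All.lookup U-low a∈) (proj₁ (partner-spec b∈)) (colourView a (partner b))

lemma2p2 : (k d : ℕ) → 1 ≤ d → Σ ℕ λ C →
    (r : ℕ) → 3 ≤ r → r ≤ k → (n : ℕ) → (G : KPartiteGraph k n) → Saturated r G →
    Σ (List (Vertex k n)) λ U →
    (length U ≤ C) ×
    (All (λ u → degree G u < d) U) ×
    (∀ x y → degree G x < d → degree G y < d → x ∉ U → y ∉ U →
    adj G x y ≡ false)
lemma2p2 k d _ = ramseyBound (length (palette k d)) , λ r _ r≤k n G saturated →
  let open SaturatedGraph G saturated
      open LowVertices d
  in U , U-small r≤k , U-low , U-covers
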